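{- Let $G$ be a digraph and let $H$ be a $2$-arc strong connectivity certificate of $G$. Then an arc $e$ is a strong bridge of $G$ if and only if $e$ is a strong bridge of $H$.
   Context: All digraphs are simple. For distinct nodes $s,t$, $\lambda_{st}(G)$ is the maximum number of pairwise arc-disjoint directed $s$–$t$ paths in $G$. A $2$-arc strong connectivity certificate of $G=(V,A)$ is a subgraph $H=(V,A')$, $A'\subseteq A$, with $\lambda_{st}(H)\ge\min\{2,\lambda_{st}(G)\}$ for all distinct $s,t\in V$. A strong bridge of a digraph is an arc whose removal increases the number of strongly connected components. -}

module Defs where

open import Data.Nat using (ℕ; _≤_; _<_)
open import Data.Fin using (Fin)
open import Data.Product using (Σ; ∃; ∃-syntax; _×_; _,_; proj₁; proj₂)
open import Data.List using (List; []; _∷_)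
open import Data.List.Membership.Propositional using (_∈_; _∉_)
open import Data.List.Relation.Unary.Unique.Propositional using (Unique)
open import Relation.Binary.PropositionalEquality using (_≡_; _≢_)

-- Arcs are ordered vertex
-- pairs, so there are no parallel arcs; simplicity = no loops.
Digraph : ℕ → Set₁
Digraph n = Fin n → Fin n → Set

Arc : ℕ → Set
Arc n = Fin n × Fin n

Loopless : ∀ {n} → Digraph n → Set
Loopless {n} A = ∀ (v : Fin n) → A v v → Data.Empty.⊥
  where import Data.Empty

_⊆ᴳ_ : ∀ {n} → Digraph n → Digraph n → Set
_⊆ᴳ_ {n} H G = ∀ (u v : Fin n) → H u v → G u v

_∖_ : ∀ {n} → Digraph n → Arc n → Digraph n
(A ∖ e) u v = A u v × ((u , v) ≢ e)

data Walk {n} (A : Digraph n) : Fin n → Fin n → Set where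
  stop : ∀ {v} → Walk A v v
  step : ∀ {u v w} → A u v → Walk A v w → Walk A u w

vertices : ∀ {n} {A : Digraph n} {s t} → Walk A s t → List (Fin n)
vertices {s = s} stop = s ∷ []
vertices {s = s} (step _ p) = s ∷ vertices p

arcs : ∀ {n} {A : Digraph n} {s t} → Walk A s t → List (Arc n)
arcs stop = []
arcs {s = s} (step {v = v} _ p) = (s , v) ∷ arcs p

Path : ∀ {n} → Digraph n → Fin n → Fin n → Set
Path A s t = Σ (Walk A s t) (λ w → Unique (vertices w))

ArcDisjoint : ∀ {n} {A : Digraph n} {s t} → Path A s t → Path A s t → Set
ArcDisjoint p q = ∀ e → e ∈ arcs (proj₁ p) → e ∉ arcs (proj₁ q)

-- "k ≤ λ_st(A)": there are k pairwise arc-disjoint directed s–t paths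
HasDisjointPaths : ∀ {n} → Digraph n → Fin n → Fin n → ℕ → Set
HasDisjointPaths A s t k =
  Σ (Fin k → Path A s t) λ ps → ∀ i j → i ≢ j → ArcDisjoint (ps i) (ps j)

-- 2-arc strong connectivity certificate:
-- λ_st(H) ≥ min{2, λ_st(G)}, i.e. for every k ≤ 2 with k ≤ λ_st(G), k ≤ λ_st(H)
Is2Certificate : ∀ {n} → Digraph n → Digraph n → Set
Is2Certificate {n} G H =
  (H ⊆ᴳ G) ×
  (∀ (s t : Fin n) → s ≢ t → ∀ (k : ℕ) → k ≤ 2 →
     HasDisjointPaths G s t k → HasDisjointPaths H s t k)

Reach : ∀ {n} → Digraph n → Fin n → Fin n → Set
Reach A u v = Walk A u v

MutReach : ∀ {n} → Digraph n → Fin n → Fin n → Set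
MutReach A u v = Reach A u v × Reach A v u

NumSCC : ∀ {n} → Digraph n → ℕ → Set
NumSCC {n} A k =
  Σ (Fin k → Fin n) λ r →
    (∀ i j → MutReach A (r i) (r j) → i ≡ j) ×
    (∀ v → ∃[ i ] MutReach A v (r i))

StrongBridge : ∀ {n} → Digraph n → Arc n → Set
StrongBridge A e =
  A (proj₁ e) (proj₂ e) ×
  ∃[ k ] ∃[ k′ ] (NumSCC A k × NumSCC (A ∖ e) k′ × k < k′)

{-# OPTIONS --safe #-}
-- Every arc uv of G is joined in H by a u–v walk (the certificate property for
-- k = 1), and H ⊆ G, so G and H have the same mutual reachability, hence the
-- same strongly connected components. The same holds for G − e and H − e: for
-- an arc uv ≠ e of G, either uv is an arc of H, or the H-walk from u to v avoids
-- uv; then uv together with the loop-erased walk are two arc-disjoint u–v paths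
-- of G, so H has two, and one of them avoids e. Finally a strong bridge e of G
-- lies in H, for otherwise the H-walk joining its ends avoids e, which would
-- give G − e the components of G.
module Submission where

open import Defs
open import Data.Nat using (ℕ; _≤_; s≤s; z≤n)
open import Data.Nat.Properties using (≤-refl; <⇒≱)
open import Data.Fin using (Fin; zero; suc)
open import Data.Fin.Properties using (injective⇒≤) renaming (_≟_ to _≟ᶠ_)
open import Data.Product using (_×_; _,_; proj₁; proj₂)
open import Data.Product.Properties using (≡-dec)
open import Data.Sum using (_⊎_; inj₁; inj₂)
open import Data.Empty using (⊥-elim)
open import Data.List using (_∷_)
open import Data.List.Membership.Propositional using (_∈_; _∉_)
open import Data.List.Relation.Unary.Any using (here; there)
open import Data.List.Relation.Unary.All using ([]; _∷_)
open import Data.List.Relation.Unary.All.Properties using (¬Any⇒All¬)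
open import Data.List.Relation.Unary.AllPairs using ([]; _∷_)
open import Data.List.Relation.Unary.Unique.Propositional using (Unique)
open import Function.Bundles using (_⇔_; mk⇔)
open import Relation.Binary.Definitions using (DecidableEquality)
open import Relation.Nullary using (¬_; yes; no)
open import Relation.Binary.PropositionalEquality using (_≡_; _≢_; refl; sym; subst; cong)

module _ {n : ℕ} where

  _≟ᵃ_ : DecidableEquality (Arc n)
  _≟ᵃ_ = ≡-dec _≟ᶠ_ _≟ᶠ_

  open import Data.List.Membership.DecPropositional _≟ᵃ_ using () renaming (_∈?_ to _∈ᵃ?_)
  open import Data.List.Membership.DecPropositional (_≟ᶠ_ {n}) using () renaming (_∈?_ to _∈ᶠ?_)

  private
    variable
      A B : Digraph n
      e : Arc n
      s t u v : Fin n
      k : ℕ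

  _++ʷ_ : Walk A s u → Walk A u t → Walk A s t
  stop     ++ʷ q = q
  step a p ++ʷ q = step a (p ++ʷ q)

  weaken : A ⊆ᴳ B → Walk A s t → Walk B s t
  weaken A⊆B stop       = stop
  weaken A⊆B (step a p) = step (A⊆B _ _ a) (weaken A⊆B p)

  vertices-weaken : (A⊆B : A ⊆ᴳ B) (p : Walk A s t) → vertices (weaken A⊆B p) ≡ vertices p
  vertices-weaken A⊆B stop       = refl
  vertices-weaken A⊆B (step a p) = cong (_ ∷_) (vertices-weaken A⊆B p)

  weakenᵖ : A ⊆ᴳ B → Path A s t → Path B s t
  weakenᵖ A⊆B (p , uniq) = weaken A⊆B p , subst Unique (sym (vertices-weaken A⊆B p)) uniq

  ∖-⊆ : (A ∖ e) ⊆ᴳ A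
  ∖-⊆ _ _ = proj₁

  ∖-mono : A ⊆ᴳ B → (A ∖ e) ⊆ᴳ (B ∖ e)
  ∖-mono A⊆B u v (a , ≢e) = A⊆B u v a , ≢e

  suffix : (p : Walk A u t) → Unique (vertices p) → s ∈ vertices p → Path A s t
  suffix stop       uniq       (here refl) = stop , uniq
  suffix (step a p) uniq       (here refl) = step a p , uniq
  suffix (step a p) (_ ∷ uniq) (there s∈p) = suffix p uniq s∈p

  erase : Walk A s t → Path A s t
  erase stop = stop , [] ∷ []
  erase {s = s} (step a w) with erase w
  ... | p , uniq with s ∈ᶠ? vertices p
  ...   | yes s∈p = suffix p uniq s∈p
  ...   | no  s∉p = step a p , ¬Any⇒All¬ _ s∉p ∷ uniq

  arcPath : s ≢ t → A s t → Path A s t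
  arcPath s≢t a = step a stop , (s≢t ∷ []) ∷ [] ∷ []

  arcs-∖ : (p : Walk (A ∖ e) s t) → e ∉ arcs (weaken ∖-⊆ p)
  arcs-∖ (step (_ , ≢e) p) (here e≡) = ≢e (sym e≡)
  arcs-∖ (step _ p)        (there e∈) = arcs-∖ p e∈

  ∈-arcs⇒arc : (p : Walk A s t) → e ∈ arcs p → A (proj₁ e) (proj₂ e)
  ∈-arcs⇒arc (step a p) (here refl) = a
  ∈-arcs⇒arc (step a p) (there e∈)  = ∈-arcs⇒arc p e∈

  ∉-arcs⇒∖ : (p : Walk A s t) → e ∉ arcs p → Walk (A ∖ e) s t
  ∉-arcs⇒∖ stop       e∉ = stop
  ∉-arcs⇒∖ (step a p) e∉ = step (a , λ ≡e → e∉ (here (sym ≡e))) (∉-arcs⇒∖ p (λ e∈ → e∉ (there e∈)))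

  uses-or-avoids : (e : Arc n) → Walk A s t → A (proj₁ e) (proj₂ e) ⊎ Walk (A ∖ e) s t
  uses-or-avoids e p with e ∈ᵃ? arcs p
  ... | yes e∈ = inj₁ (∈-arcs⇒arc p e∈)
  ... | no  e∉ = inj₂ (∉-arcs⇒∖ p e∉)

  HasDisjointPaths-one : Path A s t → HasDisjointPaths A s t 1
  HasDisjointPaths-one p = (λ _ → p) , λ { zero zero 0≢0 → ⊥-elim (0≢0 refl) }

  HasDisjointPaths-arc-bypass : ∀ {s t} → s ≢ t → A s t → Walk (A ∖ (s , t)) s t → HasDisjointPaths A s t 2
  HasDisjointPaths-arc-bypass {A = A} {s} {t} s≢t a bypass = paths , disjoint
    where
    bypassᵖ : Path (A ∖ (s , t)) s t
    bypassᵖ = erase bypass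

    paths : Fin 2 → Path A s t
    paths zero    = arcPath s≢t a
    paths (suc _) = weakenᵖ ∖-⊆ bypassᵖ

    disjoint : ∀ i j → i ≢ j → ArcDisjoint (paths i) (paths j)
    disjoint zero       zero       0≢0 = ⊥-elim (0≢0 refl)
    disjoint zero       (suc zero) _   _ (here refl) = arcs-∖ (proj₁ bypassᵖ)
    disjoint (suc zero) zero       _   _ e∈ (here refl) = arcs-∖ (proj₁ bypassᵖ) e∈
    disjoint (suc zero) (suc zero) 1≢1 = ⊥-elim (1≢1 refl)

  HasDisjointPaths-two⇒avoiding : HasDisjointPaths A s t 2 → (e : Arc n) → Walk (A ∖ e) s t
  HasDisjointPaths-two⇒avoiding (paths , disjoint) e with e ∈ᵃ? arcs (proj₁ (paths zero))
  ... | no  e∉ = ∉-arcs⇒∖ _ e∉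
  ... | yes e∈ = ∉-arcs⇒∖ _ (disjoint zero (suc zero) (λ ()) e e∈)

  _↝_ : Digraph n → Digraph n → Set
  A ↝ B = ∀ {u v} → A u v → Walk B u v

  _⇄_ : Digraph n → Digraph n → Set
  A ⇄ B = (A ↝ B) × (B ↝ A)

  ⊆⇒↝ : A ⊆ᴳ B → A ↝ B
  ⊆⇒↝ A⊆B a = step (A⊆B _ _ a) stop

  ⇄-sym : A ⇄ B → B ⇄ A
  ⇄-sym (A↝B , B↝A) = B↝A , A↝B

  walk-↝ : A ↝ B → Walk A s t → Walk B s t
  walk-↝ A↝B stop       = stop
  walk-↝ A↝B (step a p) = A↝B a ++ʷ walk-↝ A↝B p

  MutReach-↝ : A ↝ B → MutReach A u v → MutReach B u v
  MutReach-↝ A↝B (p , q) = walk-↝ A↝B p , walk-↝ A↝B q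

  -- Each component of B is sent to the component of A containing its representative.
  NumSCC-↝-≤ : ∀ {k k′} → A ↝ B → NumSCC A k → NumSCC B k′ → k′ ≤ k
  NumSCC-↝-≤ {k = k} {k′} A↝B (_ , _ , coverᴬ) (reprᴮ , distinctᴮ , _) =
    injective⇒≤ {f = componentᴬ} λ {i} {j} → same-component i j
    where
    componentᴬ : Fin k′ → Fin k
    componentᴬ i = proj₁ (coverᴬ (reprᴮ i))

    same-component : ∀ i j → componentᴬ i ≡ componentᴬ j → i ≡ j
    same-component i j eq with coverᴬ (reprᴮ i) | coverᴬ (reprᴮ j)
    same-component i j refl | c , (i↦c , c↦i) | .c , (j↦c , c↦j) =
      distinctᴮ i j (MutReach-↝ A↝B (i↦c ++ʷ c↦j , j↦c ++ʷ c↦i))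

  NumSCC-⇄ : A ⇄ B → NumSCC A k → NumSCC B k
  NumSCC-⇄ (A↝B , B↝A) (repr , distinct , cover) =
    repr , (λ i j i↔j → distinct i j (MutReach-↝ B↝A i↔j))
         , λ v → proj₁ (cover v) , MutReach-↝ A↝B (proj₂ (cover v))

  bypass⇒↝∖ : Walk (A ∖ e) (proj₁ e) (proj₂ e) → A ↝ (A ∖ e)
  bypass⇒↝∖ {e = e} bypass {u} {v} a with (u , v) ≟ᵃ e
  ... | yes refl = bypass
  ... | no  ≢e   = step (a , ≢e) stop

  StrongBridge⇒¬bypass : StrongBridge A e → ¬ Walk (A ∖ e) (proj₁ e) (proj₂ e)
  StrongBridge⇒¬bypass (_ , _ , _ , #A , #A∖e , k<k′) bypass =
    <⇒≱ k<k′ (NumSCC-↝-≤ (bypass⇒↝∖ bypass) #A #A∖e)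

  StrongBridge-transfer : A ⇄ B → (A ∖ e) ⇄ (B ∖ e) → B (proj₁ e) (proj₂ e) →
                          StrongBridge A e → StrongBridge B e
  StrongBridge-transfer A⇄B A∖e⇄B∖e b (_ , k , k′ , #A , #A∖e , k<k′) =
    b , k , k′ , NumSCC-⇄ A⇄B #A , NumSCC-⇄ A∖e⇄B∖e #A∖e , k<k′

  module Certificate (G H : Digraph n) (loopless : Loopless G) (cert : Is2Certificate G H) where

    H⊆G : H ⊆ᴳ G
    H⊆G = proj₁ cert

    arc-ends-distinct : G u v → u ≢ v
    arc-ends-distinct {u} g refl = loopless u g

    paths-in-H : ∀ k → k ≤ 2 → G u v → HasDisjointPaths G u v k → HasDisjointPaths H u v k
    paths-in-H k k≤2 g = proj₂ cert _ _ (arc-ends-distinct g) k k≤2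

    G↝H : G ↝ H
    G↝H {u} {v} g = proj₁ (proj₁ one-path zero)
      where
      one-path : HasDisjointPaths H u v 1
      one-path = paths-in-H 1 (s≤s z≤n) g (HasDisjointPaths-one (arcPath (arc-ends-distinct g) g))

    G∖e↝H∖e : (G ∖ e) ↝ (H ∖ e)
    G∖e↝H∖e {e} {u} {v} (g , ≢e) with uses-or-avoids (u , v) (G↝H g)
    ... | inj₁ h      = step (h , ≢e) stop
    ... | inj₂ bypass =
      HasDisjointPaths-two⇒avoiding
        (paths-in-H 2 ≤-refl g
          (HasDisjointPaths-arc-bypass (arc-ends-distinct g) g (weaken (∖-mono H⊆G) bypass)))
        e

    G⇄H : G ⇄ H
    G⇄H = G↝H , ⊆⇒↝ H⊆G

    G∖e⇄H∖e : (G ∖ e) ⇄ (H ∖ e)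
    G∖e⇄H∖e = G∖e↝H∖e , ⊆⇒↝ (∖-mono H⊆G)

    StrongBridge⇒arc-of-H : StrongBridge G e → H (proj₁ e) (proj₂ e)
    StrongBridge⇒arc-of-H {e} bridge with uses-or-avoids e (G↝H (proj₁ bridge))
    ... | inj₁ h      = h
    ... | inj₂ bypass = ⊥-elim (StrongBridge⇒¬bypass bridge (weaken (∖-mono H⊆G) bypass))

lemma6p13 : ∀ (n : ℕ) (G H : Digraph n) → Loopless G → Is2Certificate G H →
    ∀ (e : Arc n) → StrongBridge G e ⇔ StrongBridge H e
lemma6p13 n G H loopless cert e = mk⇔
  (λ bridge → StrongBridge-transfer G⇄H G∖e⇄H∖e (StrongBridge⇒arc-of-H bridge) bridge)
  (λ bridge → StrongBridge-transfer (⇄-sym G⇄H) (⇄-sym G∖e⇄H∖e) (H⊆G _ _ (proj₁ bridge)) bridge)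
  where open Certificate G H loopless cert
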